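{- Let $q$ be a prime power, let $A$ be a Singer cycle of $\mathrm{GL}(2,q)$, let $G_q(A)=\{(b,B): B\in\langle A\rangle,\ b\in\mathbb{F}_q^2\}$ act on the set $\Omega$ of lines of $\mathbb{F}_q^2$, and let $M_q=\bigcap_{\ell\in\mathrm{PG}(1,q)}\mathrm{Stab}(G_q(A),\Omega_\ell)$, where $\Omega_\ell=\{\ell+b:b\in\mathbb{F}_q^2\}$. Then $M_q$ is intersecting.
   Context: A Singer cycle of $\mathrm{GL}(2,q)$ is an element of order $q^2-1$. $(b,B)$ denotes the affine map $v\mapsto Bv+b$, with multiplication $(a,A)(b,B)=(a+Ab,AB)$. Lines of $\mathbb{F}_q^2$ are the sets $\{u+tv:t\in\mathbb{F}_q\}$ with $v\neq0$. $\mathrm{PG}(1,q)$ is the set of $1$-dimensional subspaces of $\mathbb{F}_q^2$; $\mathrm{Stab}(G_q(A),S)$ is the setwise stabilizer of $S\subseteq\Omega$. A subset $\mathcal{F}$ of a permutation group on $\Omega$ is intersecting if for any $\sigma,\pi\in\mathcal{F}$ there is $\omega\in\Omega$ with $\omega^\sigma=\omega^\pi$. -}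

module Defs where

open import Level using (0ℓ)
open import Data.Nat as ℕ using (ℕ; zero; suc; _∸_)
open import Data.Fin using (Fin)
open import Data.Product using (Σ; ∃; _×_; _,_)
open import Relation.Nullary using (¬_)
open import Relation.Binary.PropositionalEquality using (_≡_)
open import Function.Bundles using (_↔_)
open import Algebra.Structures using (IsCommutativeRing)
open import Data.Nat.Primality using (Prime)

IsPrimePower : ℕ → Set
IsPrimePower q = Σ ℕ λ p → Σ ℕ λ k → Prime p × q ≡ p ℕ.^ suc k

-- A finite field with exactly q elements (the standard library has no fields),
-- with propositional equality as the field equality.
record FiniteField (q : ℕ) : Set₁ where
  infixl 6 _+_
  infixl 7 _*_
  field
    Carrier : Set
    _+_ _*_ : Carrier → Carrier → Carrier
    -_      : Carrier → Carrier
    0# 1#   : Carrier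
    isCommutativeRing : IsCommutativeRing _≡_ _+_ _*_ -_ 0# 1#
    0≢1     : ¬ (0# ≡ 1#)
    inverse : ∀ x → ¬ (x ≡ 0#) → Σ Carrier λ y → x * y ≡ 1#
    enumeration : Fin q ↔ Carrier

module _ {q : ℕ} (F : FiniteField q) where
  open FiniteField F

  Vec2 : Set
  Vec2 = Carrier × Carrier

  zeroV : Vec2
  zeroV = 0# , 0#

  _⊕_ : Vec2 → Vec2 → Vec2
  (x₁ , x₂) ⊕ (y₁ , y₂) = (x₁ + y₁) , (x₂ + y₂)

  _·_ : Carrier → Vec2 → Vec2
  t · (x₁ , x₂) = (t * x₁) , (t * x₂)

  record Mat : Set where
    constructor mat
    field
      a b c d : Carrier

  det : Mat → Carrier
  det (mat a b c d) = a * d + - (b * c)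

  _▷_ : Mat → Vec2 → Vec2
  mat a b c d ▷ (x , y) = (a * x + b * y) , (c * x + d * y)

  _⊗_ : Mat → Mat → Mat
  mat a b c d ⊗ mat a' b' c' d' =
    mat (a * a' + b * c') (a * b' + b * d') (c * a' + d * c') (c * b' + d * d')

  I : Mat
  I = mat 1# 0# 0# 1#

  _^^_ : Mat → ℕ → Mat
  A ^^ zero  = I
  A ^^ suc k = A ⊗ (A ^^ k)

  InGL : Mat → Set
  InGL A = ¬ (det A ≡ 0#)

  SingerCycle : Mat → Set
  SingerCycle A = InGL A × (A ^^ (q ℕ.* q ∸ 1) ≡ I)
                  × (∀ k → 0 ℕ.< k → k ℕ.< q ℕ.* q ∸ 1 → ¬ (A ^^ k ≡ I))

  Aff : Set
  Aff = Vec2 × Mat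

  apply : Aff → Vec2 → Vec2
  apply (b , B) v = (B ▷ v) ⊕ b

  InG : Mat → Aff → Set
  InG A (b , B) = Σ ℕ λ k → B ≡ A ^^ k

  VSet : Set₁
  VSet = Vec2 → Set

  _≐_ : VSet → VSet → Set
  P ≐ Q = ∀ x → (P x → Q x) × (Q x → P x)

  lineSet : Vec2 → Vec2 → VSet
  lineSet u v x = Σ Carrier λ t → x ≡ u ⊕ (t · v)

  IsLine : VSet → Set
  IsLine L = Σ Vec2 λ u → Σ Vec2 λ v → ¬ (v ≡ zeroV) × (L ≐ lineSet u v)

  image : Aff → VSet → VSet
  image σ L x = Σ Vec2 λ y → L y × x ≡ apply σ y

  subspace : Vec2 → VSet
  subspace v x = Σ Carrier λ t → x ≡ t · v

  translate : VSet → Vec2 → VSet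
  translate ℓ b x = Σ Vec2 λ y → ℓ y × x ≡ y ⊕ b

  InΩ : VSet → VSet → Set
  InΩ ℓ L = Σ Vec2 λ b → L ≐ translate ℓ b

  Stabilizes : Aff → VSet → Set₁
  Stabilizes σ ℓ =
    (∀ L → IsLine L → InΩ ℓ L → InΩ ℓ (image σ L))
    × (∀ L → IsLine L → InΩ ℓ L → Σ VSet λ L' → IsLine L' × InΩ ℓ L' × (image σ L' ≐ L))

  InM : Mat → Aff → Set₁
  InM A σ = InG A σ × (∀ v → ¬ (v ≡ zeroV) → Stabilizes σ (subspace v))

  Intersecting : (Aff → Set₁) → Set₁
  Intersecting 𝓕 = ∀ σ π → 𝓕 σ → 𝓕 π →
    Σ VSet λ L → IsLine L × (image σ L ≐ image π L)

{-# OPTIONS --safe #-}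
-- Every σ ∈ M_q maps each parallel class of lines to itself, so it sends the line ⟨w⟩
-- through the origin to the line in direction w through σ(0). Given σ, π ∈ M_q, take w
-- to be σ(0) − π(0) (any nonzero vector if σ(0) = π(0)): then ⟨w⟩ + σ(0) = ⟨w⟩ + π(0),
-- so σ and π agree on the line ⟨w⟩.
module Submission where

open import Defs
open import Data.Nat using (ℕ)
open import Data.Product using (Σ; _×_; _,_; proj₁; proj₂)
open import Data.Product.Properties using (≡-dec)
import Data.Fin.Properties as Fin
open import Relation.Nullary using (¬_; yes; no)
open import Relation.Nullary.Decidable using (via-injection)
open import Relation.Binary.Definitions using (DecidableEquality)
open import Relation.Binary.PropositionalEquality using (_≡_)
import Relation.Binary.PropositionalEquality as ≡
open import Function.Properties.Inverse using (↔⇒↣)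
open import Function.Construct.Symmetry using (↔-sym)
open import Algebra.Bundles using (Ring)
open import Algebra.Structures using (IsCommutativeRing)

module RingIdentities {c ℓ} (R : Ring c ℓ) where
  open Ring R
  open import Algebra.Properties.Ring R using (-‿distribˡ-*)
  open import Relation.Binary.Reasoning.Setoid setoid

  +*-cancel-neg : ∀ y t w → y ≈ (y + t * w) + (- t) * w
  +*-cancel-neg y t w = begin
    y                           ≈⟨ +-identityʳ y ⟨
    y + 0#                      ≈⟨ +-congˡ (-‿inverseʳ (t * w)) ⟨
    y + (t * w + - (t * w))     ≈⟨ +-assoc y _ _ ⟨
    (y + t * w) + - (t * w)     ≈⟨ +-congˡ (-‿distribˡ-* t w) ⟩
    (y + t * w) + (- t) * w     ∎

  +*-assoc-distrib : ∀ z u t w → (z + u * w) + t * w ≈ z + (u + t) * w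
  +*-assoc-distrib z u t w = trans (+-assoc z _ _) (+-congˡ (sym (distribʳ w u t)))

  +1*-difference : ∀ x y → x ≈ y + 1# * (x + - y)
  +1*-difference x y = sym (begin
    y + 1# * (x + - y)    ≈⟨ +-congˡ (*-identityˡ _) ⟩
    y + (x + - y)         ≈⟨ +-congˡ (+-comm x _) ⟩
    y + (- y + x)         ≈⟨ +-assoc y _ _ ⟨
    (y + - y) + x         ≈⟨ +-congʳ (-‿inverseʳ y) ⟩
    0# + x                ≈⟨ +-identityˡ x ⟩
    x                     ∎)

  +-zeroʳ-zeroˡ : ∀ y t w → y + t * 0# ≈ y + 0# * w
  +-zeroʳ-zeroˡ y t w = +-congˡ (trans (zeroʳ t) (sym (zeroˡ w)))

module _ {q : ℕ} (F : FiniteField q) where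
  open FiniteField F
  open ≡ using (refl; sym; trans; cong; cong₂; subst)
  open IsCommutativeRing isCommutativeRing using (+-comm; +-identityˡ; +-identityʳ; zeroˡ)

  _≟_ : DecidableEquality Carrier
  _≟_ = via-injection (↔⇒↣ (↔-sym enumeration)) Fin._≟_

  ring : Ring _ _
  ring = record { isRing = IsCommutativeRing.isRing isCommutativeRing }

  open RingIdentities ring

  _≟ᵛ_ : DecidableEquality (Vec2 F)
  _≟ᵛ_ = ≡-dec _≟_ _≟_

  _⊖_ : Vec2 F → Vec2 F → Vec2 F
  (x₁ , x₂) ⊖ (y₁ , y₂) = (x₁ + - y₁) , (x₂ + - y₂)

  _∼[_]_ : Vec2 F → Vec2 F → Vec2 F → Set
  x ∼[ w ] y = Σ Carrier λ t → x ≡ _⊕_ F y (_·_ F t w)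

  ∼-sym : ∀ {w x y} → x ∼[ w ] y → y ∼[ w ] x
  ∼-sym {w₁ , w₂} {y = y₁ , y₂} (t , refl) =
    - t , cong₂ _,_ (+*-cancel-neg y₁ t w₁) (+*-cancel-neg y₂ t w₂)

  ∼-trans : ∀ {w x y z} → x ∼[ w ] y → y ∼[ w ] z → x ∼[ w ] z
  ∼-trans {w₁ , w₂} (t , refl) (u , refl) =
    u + t , cong₂ _,_ (+*-assoc-distrib _ u t w₁) (+*-assoc-distrib _ u t w₂)

  ∼-difference : ∀ x y → x ∼[ x ⊖ y ] y
  ∼-difference (x₁ , x₂) (y₁ , y₂) =
    1# , cong₂ _,_ (+1*-difference x₁ y₁) (+1*-difference x₂ y₂)

  ∼-zero-direction : ∀ {x y} w → x ∼[ zeroV F ] y → x ∼[ w ] y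
  ∼-zero-direction (w₁ , w₂) (t , refl) = 0# , cong₂ _,_ (+-zeroʳ-zeroˡ _ t w₁) (+-zeroʳ-zeroˡ _ t w₂)

  e₁≢0 : ¬ ((1# , 0#) ≡ zeroV F)
  e₁≢0 e = 0≢1 (sym (cong proj₁ e))

  common-direction : ∀ x y → Σ (Vec2 F) λ w → ¬ (w ≡ zeroV F) × x ∼[ w ] y
  common-direction x y with (x ⊖ y) ≟ᵛ zeroV F
  ... | yes d≡0 = (1# , 0#) , e₁≢0 , ∼-zero-direction _ (subst (x ∼[_] y) d≡0 (∼-difference x y))
  ... | no d≢0  = x ⊖ y , d≢0 , ∼-difference x y

  translate-subspace⇒∼ : ∀ {w b x} → translate F (subspace F w) b x → x ∼[ w ] b
  translate-subspace⇒∼ {w₁ , w₂} {b₁ , b₂} (_ , (s , refl) , refl) =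
    s , cong₂ _,_ (+-comm (s * w₁) b₁) (+-comm (s * w₂) b₂)

  ∼⇒translate-subspace : ∀ {w b x} → x ∼[ w ] b → translate F (subspace F w) b x
  ∼⇒translate-subspace {w₁ , w₂} {b₁ , b₂} (s , refl) =
    _ , (s , refl) , cong₂ _,_ (+-comm b₁ (s * w₁)) (+-comm b₂ (s * w₂))

  translate-subspace-cong : ∀ {w b c} → b ∼[ w ] c →
    _≐_ F (translate F (subspace F w) b) (translate F (subspace F w) c)
  translate-subspace-cong b∼c x =
    (λ h → ∼⇒translate-subspace (∼-trans (translate-subspace⇒∼ h) b∼c)) ,
    (λ h → ∼⇒translate-subspace (∼-trans (translate-subspace⇒∼ h) (∼-sym b∼c)))

  ≐-trans : ∀ {P Q R} → _≐_ F P Q → _≐_ F Q R → _≐_ F P R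
  ≐-trans P≐Q Q≐R x =
    (λ p → proj₁ (Q≐R x) (proj₁ (P≐Q x) p)) , (λ r → proj₂ (P≐Q x) (proj₂ (Q≐R x) r))

  ≐-sym : ∀ {P Q} → _≐_ F P Q → _≐_ F Q P
  ≐-sym P≐Q x = proj₂ (P≐Q x) , proj₁ (P≐Q x)

  zero∈subspace : ∀ w → subspace F w (zeroV F)
  zero∈subspace (w₁ , w₂) = 0# , sym (cong₂ _,_ (zeroˡ w₁) (zeroˡ w₂))

  subspace-isLine : ∀ {w} → ¬ (w ≡ zeroV F) → IsLine F (subspace F w)
  subspace-isLine {w} w≢0 = zeroV F , w , w≢0 , λ x →
    (λ { (t , e) → t , trans e (sym (⊕-identityˡ _)) }) ,
    (λ { (t , e) → t , trans e (⊕-identityˡ _) })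
    where
    ⊕-identityˡ : ∀ v → _⊕_ F (zeroV F) v ≡ v
    ⊕-identityˡ (v₁ , v₂) = cong₂ _,_ (+-identityˡ v₁) (+-identityˡ v₂)

  subspace-InΩ : ∀ w → InΩ F (subspace F w) (subspace F w)
  subspace-InΩ w = zeroV F , λ x →
    (λ h → x , h , sym (⊕-identityʳ x)) ,
    (λ { (y , h , refl) → subst (subspace F w) (sym (⊕-identityʳ y)) h })
    where
    ⊕-identityʳ : ∀ v → _⊕_ F v (zeroV F) ≡ v
    ⊕-identityʳ (v₁ , v₂) = cong₂ _,_ (+-identityʳ v₁) (+-identityʳ v₂)

  image-subspace : ∀ σ w → InΩ F (subspace F w) (image F σ (subspace F w)) →
    _≐_ F (image F σ (subspace F w)) (translate F (subspace F w) (apply F σ (zeroV F)))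
  image-subspace σ w (b , image≐translate) =
    ≐-trans image≐translate (translate-subspace-cong (∼-sym σ0∼b))
    where
    σ0∼b : apply F σ (zeroV F) ∼[ w ] b
    σ0∼b = translate-subspace⇒∼ (proj₁ (image≐translate _) (zeroV F , zero∈subspace w , refl))

  parallelism-preserving-intersecting : (𝓕 : Aff F → Set₁) →
    (∀ σ → 𝓕 σ → ∀ w → ¬ (w ≡ zeroV F) → InΩ F (subspace F w) (image F σ (subspace F w))) →
    Intersecting F 𝓕
  parallelism-preserving-intersecting 𝓕 preserves σ π σ∈𝓕 π∈𝓕 =
    subspace F w , subspace-isLine w≢0 ,
    ≐-trans (image-subspace σ w (preserves σ σ∈𝓕 w w≢0))
      (≐-trans (translate-subspace-cong σ0∼π0) (≐-sym (image-subspace π w (preserves π π∈𝓕 w w≢0))))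
    where
    direction = common-direction (apply F σ (zeroV F)) (apply F π (zeroV F))
    w = proj₁ direction
    w≢0 = proj₁ (proj₂ direction)
    σ0∼π0 = proj₂ (proj₂ direction)

corollary3p5 : (q : ℕ) → IsPrimePower q → (F : FiniteField q) → (A : Mat F)
    → SingerCycle F A → Intersecting F (InM F A)
corollary3p5 q _ F A _ = parallelism-preserving-intersecting F (InM F A)
  λ { σ (_ , stabilizes) w w≢0 →
        proj₁ (stabilizes w w≢0) _ (subspace-isLine F w≢0) (subspace-InΩ F w) }
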